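{- Let $d\ge 1$ be an integer and let $\mathbf e_1,\dots,\mathbf e_{2d+1}$ be the standard basis of $\mathbb R^{2d+1}$. For $i,j\in[d]=\{1,\dots,d\}$ let $\mathbf a_{ij}=\mathbf e_j+\mathbf e_{d+i}+\delta_{ij}\mathbf e_{2d+1}\in\mathbb Z^{2d+1}$ (where $\delta_{ij}=1$ if $i=j$ and $0$ otherwise), and let $A\in\mathbb Z^{(2d+1)\times d^2}$ be the matrix whose $((i-1)d+j)$-th column is $\mathbf a_{ij}$. Let $K=\{\sum_{i,j}x_{ij}\mathbf a_{ij}: x_{ij}\in\mathbb R_{\ge0}\}$, $Q=\{\sum_{i,j}x_{ij}\mathbf a_{ij}: x_{ij}\in\mathbb Z_{\ge0}\}$ and $Q_{\mathrm{sat}}=K\cap\mathbb Z^{2d+1}$. For $k,l\in[d]$ put $\mathbf h_{kl}=\tfrac12(\mathbf a_{ll}+\mathbf a_{lk}+\mathbf a_{kl}+\mathbf a_{kk})$ and let $\mathcal F=\{\mathbf h_{kl}: k,l\in[d],\ k<l\}$. Then $\mathcal F\subset K\cap\mathbb Z^{2d+1}$ and $\mathcal F\subseteq Q_{\mathrm{sat}}\setminus Q$.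
   Context: The matrix $A$ maps a $d\times d$ table to its column sums, row sums and diagonal sum (common diagonal effect model). $Q$ is the semigroup generated by the columns of $A$, $K$ the cone they generate, and $Q_{\mathrm{sat}}$ the saturation of $Q$; elements of $Q_{\mathrm{sat}}\setminus Q$ are called holes. -}

module Defs where

open import Data.Nat using (ℕ) renaming (_+_ to _+ℕ_)
open import Data.Integer using (ℤ; +_)
open import Data.Fin using (Fin; zero; suc; _↑ˡ_; _↑ʳ_; _≟_)
open import Data.Rational using (ℚ; 0ℚ; 1ℚ; ½; _+_; _*_; _≤_; _/_)
open import Data.Product using (Σ; _×_; ∃)
open import Relation.Nullary using (yes; no)
open import Relation.Binary.PropositionalEquality using (_≡_)

Vecℚ : ℕ → Set
Vecℚ n = Fin n → ℚ

e : {n : ℕ} → Fin n → Vecℚ n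
e c x with c ≟ x
... | yes _ = 1ℚ
... | no  _ = 0ℚ

_⊕_ : {n : ℕ} → Vecℚ n → Vecℚ n → Vecℚ n
(u ⊕ v) x = u x + v x

_⊙_ : {n : ℕ} → ℚ → Vecℚ n → Vecℚ n
(q ⊙ v) x = q * v x

δ : {d : ℕ} → Fin d → Fin d → ℚ
δ i j with i ≟ j
... | yes _ = 1ℚ
... | no  _ = 0ℚ

-- Coordinates of ℚ^{2d+1}, indexed by Fin (d +ℕ d +ℕ 1):
--   col j  ↦ coordinate j          (e_j,        j ∈ [d])
--   row i  ↦ coordinate d + i      (e_{d+i},    i ∈ [d])
--   diag   ↦ coordinate 2d + 1     (e_{2d+1})
col : {d : ℕ} → Fin d → Fin (d +ℕ d +ℕ 1)
col {d} j = (j ↑ˡ d) ↑ˡ 1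

row : {d : ℕ} → Fin d → Fin (d +ℕ d +ℕ 1)
row {d} i = (d ↑ʳ i) ↑ˡ 1

diag : {d : ℕ} → Fin (d +ℕ d +ℕ 1)
diag {d} = (d +ℕ d) ↑ʳ zero

a : {d : ℕ} → Fin d → Fin d → Vecℚ (d +ℕ d +ℕ 1)
a {d} i j = (e (col {d} j) ⊕ e (row {d} i)) ⊕ (δ i j ⊙ e (diag {d}))

sumFin : {n : ℕ} → (Fin n → ℚ) → ℚ
sumFin {ℕ.zero}  f = 0ℚ
sumFin {ℕ.suc n} f = f zero + sumFin (λ i → f (suc i))

comb : {d : ℕ} → (Fin d → Fin d → ℚ) → Vecℚ (d +ℕ d +ℕ 1)
comb {d} x c = sumFin (λ i → sumFin (λ j → x i j * a i j c))

ℕtoℚ : ℕ → ℚ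
ℕtoℚ m = (+ m) / 1

ℤtoℚ : ℤ → ℚ
ℤtoℚ z = z / 1

InK : (d : ℕ) → Vecℚ (d +ℕ d +ℕ 1) → Set
InK d v = Σ (Fin d → Fin d → ℚ) λ x → (∀ i j → 0ℚ ≤ x i j) × (∀ c → comb x c ≡ v c)

IsIntegral : {n : ℕ} → Vecℚ n → Set
IsIntegral {n} v = ∀ (c : Fin n) → ∃ λ (z : ℤ) → v c ≡ ℤtoℚ z

InQ : (d : ℕ) → Vecℚ (d +ℕ d +ℕ 1) → Set
InQ d v = Σ (Fin d → Fin d → ℕ) λ x → ∀ c → comb (λ i j → ℕtoℚ (x i j)) c ≡ v c

InQsat : (d : ℕ) → Vecℚ (d +ℕ d +ℕ 1) → Set
InQsat d v = InK d v × IsIntegral v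

h : {d : ℕ} → Fin d → Fin d → Vecℚ (d +ℕ d +ℕ 1)
h k l = ½ ⊙ (((a l l ⊕ a l k) ⊕ a k l) ⊕ a k k)

module Submission where

open import Defs
open import Algebra.Bundles using (CommutativeMonoid)
import Algebra.Properties.CommutativeMonoid.Sum as CommutativeMonoidSum
open import Data.Nat as ℕ using (ℕ; _≤_; zero; suc)
import Data.Nat.Properties as ℕP
open import Data.Nat.Coprimality using (1-coprimeTo) renaming (sym to coprime-sym)
open import Data.Fin as Fin using (Fin; _<_; zero; suc; _↑ˡ_; _↑ʳ_; splitAt)
import Data.Fin.Properties as FinP
import Data.Integer as ℤ
import Data.Integer.Properties as ℤP
open import Data.Rational as ℚ using (ℚ; mkℚ; ↥_; ½; 0ℚ; 1ℚ; _+_; _*_; NonNegative)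
import Data.Rational.Properties as ℚP
open import Data.Rational.Solver using (module +-*-Solver)
open import Data.Product using (_×_; _,_; ∃; map₂)
open import Data.Sum using (inj₁; inj₂)
open import Function using (_∘_)
open import Relation.Nullary using (¬_; yes; no; contradiction)
open import Relation.Binary.PropositionalEquality
  using (_≡_; _≢_; refl; sym; trans; cong; cong₂; subst; ≢-sym; module ≡-Reasoning)

-- Coordinatewise, h_kl = e_k + e_l + e_{d+k} + e_{d+l} + e_{2d+1}: it is integral, and it is
-- ½ Σ_{i,j ∈ {k,l}} a_ij, so it lies in K.  If a table x of naturals had A x = h_kl, then all
-- margins outside {k,l} vanish, so x is supported on the block {k,l}²; there row k and column l
-- give x_kk + x_kl = 1 = x_kl + x_ll, hence x_kk = x_ll and the diagonal sum x_kk + x_ll is even,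
-- whereas the last coordinate of h_kl is 1.

module SupportedSum {c ℓ} (M : CommutativeMonoid c ℓ) where
  open CommutativeMonoid M
    using (Carrier; _≈_; _∙_; ε; setoid; comm; identityˡ; identityʳ; ∙-cong; ∙-congˡ)
  open CommutativeMonoidSum M using (sum; sum-cong-≋; sum-replicate-zero)
  open import Relation.Binary.Reasoning.Setoid setoid

  sum-zero : ∀ {n} {f : Fin n → Carrier} → (∀ i → f i ≈ ε) → sum f ≈ ε
  sum-zero {n} {f} f≈ε = begin
    sum f             ≈⟨ sum-cong-≋ f≈ε ⟩
    sum {n} (λ _ → ε) ≈⟨ sum-replicate-zero n ⟩
    ε                 ∎

  sum-single : ∀ {n} {f : Fin n → Carrier} k → (∀ i → i ≢ k → f i ≈ ε) → sum f ≈ f k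
  sum-single {f = f} zero f≈ε = begin
    f zero ∙ sum (f ∘ suc) ≈⟨ ∙-congˡ (sum-zero λ i → f≈ε (suc i) λ ()) ⟩
    f zero ∙ ε             ≈⟨ identityʳ (f zero) ⟩
    f zero                 ∎
  sum-single {f = f} (suc k) f≈ε = begin
    f zero ∙ sum (f ∘ suc) ≈⟨ ∙-cong (f≈ε zero λ ())
                                     (sum-single k λ i i≢k → f≈ε (suc i) (i≢k ∘ FinP.suc-injective)) ⟩
    ε ∙ f (suc k)          ≈⟨ identityˡ (f (suc k)) ⟩
    f (suc k)              ∎

  sum-pair : ∀ {n} {f : Fin n → Carrier} {k l} → k ≢ l →
             (∀ i → i ≢ k → i ≢ l → f i ≈ ε) → sum f ≈ f k ∙ f l
  sum-pair {k = zero} {zero} k≢l _ = contradiction refl k≢l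
  sum-pair {f = f} {zero} {suc l} _ f≈ε =
    ∙-congˡ (sum-single l λ i i≢l → f≈ε (suc i) (λ ()) (i≢l ∘ FinP.suc-injective))
  sum-pair {f = f} {suc k} {zero} _ f≈ε = begin
    f zero ∙ sum (f ∘ suc) ≈⟨ ∙-congˡ (sum-single k λ i i≢k →
                                f≈ε (suc i) (i≢k ∘ FinP.suc-injective) (λ ())) ⟩
    f zero ∙ f (suc k)     ≈⟨ comm (f zero) (f (suc k)) ⟩
    f (suc k) ∙ f zero     ∎
  sum-pair {f = f} {suc k} {suc l} k≢l f≈ε = begin
    f zero ∙ sum (f ∘ suc)      ≈⟨ ∙-cong (f≈ε zero (λ ()) (λ ())) (sum-pair (k≢l ∘ cong suc) λ i i≢k i≢l →
                                     f≈ε (suc i) (i≢k ∘ FinP.suc-injective) (i≢l ∘ FinP.suc-injective)) ⟩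
    ε ∙ (f (suc k) ∙ f (suc l)) ≈⟨ identityˡ _ ⟩
    f (suc k) ∙ f (suc l)       ∎

open CommutativeMonoidSum ℕP.+-0-commutativeMonoid using () renaming (sum to ∑ℕ)
open SupportedSum ℕP.+-0-commutativeMonoid using () renaming (sum-pair to ∑ℕ-pair)

∑ℕ≡0⇒≡0 : ∀ {n} (f : Fin n → ℕ) → ∑ℕ f ≡ 0 → ∀ i → f i ≡ 0
∑ℕ≡0⇒≡0 f ∑f≡0 zero    = ℕP.m+n≡0⇒m≡0 (f zero) ∑f≡0
∑ℕ≡0⇒≡0 f ∑f≡0 (suc i) = ∑ℕ≡0⇒≡0 (f ∘ suc) (ℕP.m+n≡0⇒n≡0 (f zero) ∑f≡0) i

n+n≢1 : ∀ n → n ℕ.+ n ≢ 1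
n+n≢1 (suc n) eq with () ← trans (sym (ℕP.+-suc n n)) (ℕP.suc-injective eq)

rowSum : ∀ {d} → (Fin d → Fin d → ℕ) → Fin d → ℕ
rowSum x i = ∑ℕ (x i)

colSum : ∀ {d} → (Fin d → Fin d → ℕ) → Fin d → ℕ
colSum x j = ∑ℕ (λ i → x i j)

trace : ∀ {d} → (Fin d → Fin d → ℕ) → ℕ
trace x = ∑ℕ (λ i → x i i)

block-trace≢1 : ∀ {d} (x : Fin d → Fin d → ℕ) {k l : Fin d} → k ≢ l →
                (∀ i → i ≢ k → i ≢ l → rowSum x i ≡ 0) →
                (∀ j → j ≢ k → j ≢ l → colSum x j ≡ 0) →
                rowSum x k ≡ 1 → colSum x l ≡ 1 → trace x ≢ 1
block-trace≢1 x {k} {l} k≢l rows-outside cols-outside rowₖ≡1 colₗ≡1 trace≡1 =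
  n+n≢1 (x l l) (begin
    x l l ℕ.+ x l l ≡⟨ cong (ℕ._+ x l l) (sym diagonal-balanced) ⟩
    x k k ℕ.+ x l l ≡⟨ sym (∑ℕ-pair k≢l λ i i≢k i≢l → outside-rows i i≢k i≢l i) ⟩
    trace x         ≡⟨ trace≡1 ⟩
    1               ∎)
  where
  open ≡-Reasoning
  outside-rows : ∀ i → i ≢ k → i ≢ l → ∀ j → x i j ≡ 0
  outside-rows i i≢k i≢l = ∑ℕ≡0⇒≡0 (x i) (rows-outside i i≢k i≢l)
  outside-cols : ∀ j → j ≢ k → j ≢ l → ∀ i → x i j ≡ 0
  outside-cols j j≢k j≢l = ∑ℕ≡0⇒≡0 (λ i → x i j) (cols-outside j j≢k j≢l)
  rowₖ : x k k ℕ.+ x k l ≡ 1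
  rowₖ = trans (sym (∑ℕ-pair k≢l λ j j≢k j≢l → outside-cols j j≢k j≢l k)) rowₖ≡1
  colₗ : x k l ℕ.+ x l l ≡ 1
  colₗ = trans (sym (∑ℕ-pair k≢l λ i i≢k i≢l → outside-rows i i≢k i≢l l)) colₗ≡1
  diagonal-balanced : x k k ≡ x l l
  diagonal-balanced =
    ℕP.+-cancelˡ-≡ (x k l) _ _ (trans (ℕP.+-comm (x k l) (x k k)) (trans rowₖ (sym colₗ)))

open CommutativeMonoidSum ℚP.+-0-commutativeMonoid using () renaming (sum to ∑ℚ; sum-cong-≗ to ∑ℚ-cong)
open SupportedSum ℚP.+-0-commutativeMonoid using ()
  renaming (sum-zero to ∑ℚ-zero; sum-single to ∑ℚ-single; sum-pair to ∑ℚ-pair)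

sumFin≡∑ℚ : ∀ {n} (f : Fin n → ℚ) → sumFin f ≡ ∑ℚ f
sumFin≡∑ℚ {zero}  f = refl
sumFin≡∑ℚ {suc n} f = cong (f zero +_) (sumFin≡∑ℚ (f ∘ suc))

ℕtoℚ≡mkℚ : ∀ m → ℕtoℚ m ≡ mkℚ (ℤ.+ m) 0 (coprime-sym (1-coprimeTo m))
ℕtoℚ≡mkℚ m = ℚP.normalize-coprime (coprime-sym (1-coprimeTo m))

ℕtoℚ-injective : ∀ {m n} → ℕtoℚ m ≡ ℕtoℚ n → m ≡ n
ℕtoℚ-injective {m} {n} eq =
  ℤP.+-injective (cong ↥_ (trans (sym (ℕtoℚ≡mkℚ m)) (trans eq (ℕtoℚ≡mkℚ n))))

ℕtoℚ-homo-+ : ∀ m n → ℕtoℚ (m ℕ.+ n) ≡ ℕtoℚ m + ℕtoℚ n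
ℕtoℚ-homo-+ m n = sym (trans (cong₂ _+_ (ℕtoℚ≡mkℚ m) (ℕtoℚ≡mkℚ n))
  (ℚP./-cong (cong₂ ℤ._+_ (ℤP.*-identityʳ (ℤ.+ m)) (ℤP.*-identityʳ (ℤ.+ n))) refl))

ℕtoℚ-∑ : ∀ {n} (f : Fin n → ℕ) → ℕtoℚ (∑ℕ f) ≡ ∑ℚ (ℕtoℚ ∘ f)
ℕtoℚ-∑ {zero}  f = refl
ℕtoℚ-∑ {suc n} f =
  trans (ℕtoℚ-homo-+ (f zero) (∑ℕ (f ∘ suc))) (cong (ℕtoℚ (f zero) +_) (ℕtoℚ-∑ (f ∘ suc)))

δ-refl : ∀ {n} (i : Fin n) → δ i i ≡ 1ℚ
δ-refl i with i Fin.≟ i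
... | yes _  = refl
... | no i≢i = contradiction refl i≢i

δ-≢ : ∀ {n} {i j : Fin n} → i ≢ j → δ i j ≡ 0ℚ
δ-≢ {i = i} {j} i≢j with i Fin.≟ j
... | yes i≡j = contradiction i≡j i≢j
... | no _    = refl

δ-nonNeg : ∀ {n} (i j : Fin n) → NonNegative (δ i j)
δ-nonNeg i j with i Fin.≟ j
... | yes _ = _
... | no _  = _

e≡δ : ∀ {n} (i j : Fin n) → e i j ≡ δ i j
e≡δ i j with i Fin.≟ j
... | yes _ = refl
... | no _  = refl

e-refl : ∀ {n} (i : Fin n) → e i i ≡ 1ℚ
e-refl i = trans (e≡δ i i) (δ-refl i)

e-≢ : ∀ {n} {i j : Fin n} → i ≢ j → e i j ≡ 0ℚ
e-≢ {i = i} {j} i≢j = trans (e≡δ i j) (δ-≢ i≢j)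

e-reindex : ∀ {m n} {f : Fin m → Fin n} → (∀ {i j} → f i ≡ f j → i ≡ j) →
            ∀ i j → e (f i) (f j) ≡ δ i j
e-reindex {f = f} f-injective i j with i Fin.≟ j
... | yes refl = e-refl (f i)
... | no i≢j   = e-≢ (i≢j ∘ f-injective)

↑ˡ≢↑ʳ : ∀ {m n} (i : Fin m) (j : Fin n) → i ↑ˡ n ≢ m ↑ʳ j
↑ˡ≢↑ʳ {m} {n} i j eq
  with () ← trans (sym (FinP.splitAt-↑ˡ m i n)) (trans (cong (splitAt m) eq) (FinP.splitAt-↑ʳ m n j))

module _ {d : ℕ} where

  col-injective : ∀ {i j : Fin d} → col {d} i ≡ col j → i ≡ j
  col-injective = FinP.↑ˡ-injective d _ _ ∘ FinP.↑ˡ-injective 1 _ _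

  row-injective : ∀ {i j : Fin d} → row {d} i ≡ row j → i ≡ j
  row-injective = FinP.↑ʳ-injective d _ _ ∘ FinP.↑ˡ-injective 1 _ _

  col≢row : ∀ (j i : Fin d) → col {d} j ≢ row i
  col≢row j i = ↑ˡ≢↑ʳ j i ∘ FinP.↑ˡ-injective 1 _ _

  col≢diag : ∀ (j : Fin d) → col {d} j ≢ diag {d}
  col≢diag j = ↑ˡ≢↑ʳ (j ↑ˡ d) zero

  row≢diag : ∀ (i : Fin d) → row {d} i ≢ diag {d}
  row≢diag i = ↑ˡ≢↑ʳ (d ↑ʳ i) zero

  data Coordinate : Fin (d ℕ.+ d ℕ.+ 1) → Set where
    at-col  : (j : Fin d) → Coordinate (col {d} j)
    at-row  : (i : Fin d) → Coordinate (row {d} i)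
    at-diag : Coordinate (diag {d})

  coordinate : (c : Fin (d ℕ.+ d ℕ.+ 1)) → Coordinate c
  coordinate c with splitAt (d ℕ.+ d) c in c≡
  ... | inj₂ zero = subst Coordinate (FinP.splitAt⁻¹-↑ʳ c≡) at-diag
  ... | inj₁ c′ with splitAt d c′ in c′≡
  ...   | inj₁ j =
    subst Coordinate (trans (cong (_↑ˡ 1) (FinP.splitAt⁻¹-↑ˡ c′≡)) (FinP.splitAt⁻¹-↑ˡ c≡)) (at-col j)
  ...   | inj₂ i =
    subst Coordinate (trans (cong (_↑ˡ 1) (FinP.splitAt⁻¹-↑ʳ c′≡)) (FinP.splitAt⁻¹-↑ˡ c≡)) (at-row i)

module _ {d : ℕ} (i j : Fin d) where
  open ≡-Reasoning

  a-col : ∀ m → a i j (col {d} m) ≡ δ j m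
  a-col m = begin
    a i j (col {d} m)                                                              ≡⟨⟩
    (e (col {d} j) (col m) + e (row {d} i) (col m)) + δ i j * e (diag {d}) (col m) ≡⟨
      cong₂ _+_ (cong₂ _+_ (e-reindex (col-injective {d}) j m) (e-≢ (col≢row {d} m i ∘ sym)))
                (cong (δ i j *_) (e-≢ (col≢diag {d} m ∘ sym))) ⟩
    (δ j m + 0ℚ) + δ i j * 0ℚ ≡⟨ cong₂ _+_ (ℚP.+-identityʳ (δ j m)) (ℚP.*-zeroʳ (δ i j)) ⟩
    δ j m + 0ℚ                ≡⟨ ℚP.+-identityʳ (δ j m) ⟩
    δ j m                     ∎

  a-row : ∀ m → a i j (row {d} m) ≡ δ i m
  a-row m = begin
    a i j (row {d} m)                                                              ≡⟨⟩
    (e (col {d} j) (row m) + e (row {d} i) (row m)) + δ i j * e (diag {d}) (row m) ≡⟨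
      cong₂ _+_ (cong₂ _+_ (e-≢ (col≢row {d} j m)) (e-reindex (row-injective {d}) i m))
                (cong (δ i j *_) (e-≢ (row≢diag {d} m ∘ sym))) ⟩
    (0ℚ + δ i m) + δ i j * 0ℚ ≡⟨ cong₂ _+_ (ℚP.+-identityˡ (δ i m)) (ℚP.*-zeroʳ (δ i j)) ⟩
    δ i m + 0ℚ                ≡⟨ ℚP.+-identityʳ (δ i m) ⟩
    δ i m                     ∎

  a-diag : a i j (diag {d}) ≡ δ i j
  a-diag = begin
    a i j (diag {d})                                                                    ≡⟨⟩
    (e (col {d} j) (diag {d}) + e (row i) (diag {d})) + δ i j * e (diag {d}) (diag {d}) ≡⟨
      cong₂ _+_ (cong₂ _+_ (e-≢ (col≢diag {d} j)) (e-≢ (row≢diag {d} i)))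
                (cong (δ i j *_) (e-refl (diag {d}))) ⟩
    (0ℚ + 0ℚ) + δ i j * 1ℚ ≡⟨ ℚP.+-identityˡ (δ i j * 1ℚ) ⟩
    δ i j * 1ℚ             ≡⟨ ℚP.*-identityʳ (δ i j) ⟩
    δ i j                  ∎

∑ℚ-*-indicator : ∀ {n} (f w : Fin n → ℚ) m → w m ≡ 1ℚ → (∀ j → j ≢ m → w j ≡ 0ℚ) →
                 ∑ℚ (λ j → f j * w j) ≡ f m
∑ℚ-*-indicator f w m wₘ≡1 w≡0 = trans
  (∑ℚ-single m λ j j≢m → trans (cong (f j *_) (w≡0 j j≢m)) (ℚP.*-zeroʳ (f j)))
  (trans (cong (f m *_) wₘ≡1) (ℚP.*-identityʳ (f m)))

module _ {d : ℕ} (y : Fin d → Fin d → ℚ) where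
  open ≡-Reasoning

  comb≡∑∑ : ∀ c → comb y c ≡ ∑ℚ (λ i → ∑ℚ (λ j → y i j * a i j c))
  comb≡∑∑ c = trans (sumFin≡∑ℚ (λ i → sumFin (λ j → y i j * a i j c)))
                    (∑ℚ-cong λ i → sumFin≡∑ℚ (λ j → y i j * a i j c))

  comb-col : ∀ m → comb y (col {d} m) ≡ ∑ℚ (λ i → y i m)
  comb-col m = trans (comb≡∑∑ (col m)) (∑ℚ-cong λ i → begin
    ∑ℚ (λ j → y i j * a i j (col m)) ≡⟨ ∑ℚ-cong (λ j → cong (y i j *_) (a-col i j m)) ⟩
    ∑ℚ (λ j → y i j * δ j m)         ≡⟨ ∑ℚ-*-indicator (y i) (λ j → δ j m) m (δ-refl m) (λ j → δ-≢) ⟩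
    y i m                            ∎)

  comb-row : ∀ m → comb y (row {d} m) ≡ ∑ℚ (y m)
  comb-row m = begin
    comb y (row m)                              ≡⟨ comb≡∑∑ (row m) ⟩
    ∑ℚ (λ i → ∑ℚ (λ j → y i j * a i j (row m))) ≡⟨ ∑ℚ-cong (λ i → ∑ℚ-cong λ j → cong (y i j *_) (a-row i j m)) ⟩
    ∑ℚ (λ i → ∑ℚ (λ j → y i j * δ i m))         ≡⟨ ∑ℚ-single m other-rows ⟩
    ∑ℚ (λ j → y m j * δ m m)                    ≡⟨ ∑ℚ-cong (λ j → cong (y m j *_) (δ-refl m)) ⟩
    ∑ℚ (λ j → y m j * 1ℚ)                       ≡⟨ ∑ℚ-cong (λ j → ℚP.*-identityʳ (y m j)) ⟩
    ∑ℚ (y m)                                    ∎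
    where
    other-rows : ∀ i → i ≢ m → ∑ℚ (λ j → y i j * δ i m) ≡ 0ℚ
    other-rows i i≢m = ∑ℚ-zero λ j → trans (cong (y i j *_) (δ-≢ i≢m)) (ℚP.*-zeroʳ (y i j))

  comb-diag : comb y (diag {d}) ≡ ∑ℚ (λ i → y i i)
  comb-diag = trans (comb≡∑∑ (diag {d})) (∑ℚ-cong λ i → begin
    ∑ℚ (λ j → y i j * a i j (diag {d})) ≡⟨ ∑ℚ-cong (λ j → cong (y i j *_) (a-diag i j)) ⟩
    ∑ℚ (λ j → y i j * δ i j)            ≡⟨ ∑ℚ-*-indicator (y i) (δ i) i (δ-refl i) (λ j → δ-≢ ∘ ≢-sym) ⟩
    y i i                               ∎)

module _ {d : ℕ} {k l : Fin d} (k≢l : k ≢ l) where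
  open +-*-Solver
  open ≡-Reasoning

  χ : Fin d → ℚ
  χ m = δ k m + δ l m

  χ-nonNeg : ∀ m → NonNegative (χ m)
  χ-nonNeg m = ℚP.nonNeg+nonNeg⇒nonNeg (δ k m) {{δ-nonNeg k m}} (δ l m) {{δ-nonNeg l m}}

  χ-left : χ k ≡ 1ℚ
  χ-left = cong₂ _+_ (δ-refl k) (δ-≢ (≢-sym k≢l))

  χ-right : χ l ≡ 1ℚ
  χ-right = cong₂ _+_ (δ-≢ k≢l) (δ-refl l)

  χ-outside : ∀ {m} → m ≢ k → m ≢ l → χ m ≡ 0ℚ
  χ-outside m≢k m≢l = cong₂ _+_ (δ-≢ (≢-sym m≢k)) (δ-≢ (≢-sym m≢l))

  χ-integral : ∀ m → ∃ λ z → χ m ≡ ℤtoℚ z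
  χ-integral m with m Fin.≟ k | m Fin.≟ l
  ... | yes refl | _        = ℤ.+ 1 , χ-left
  ... | no _     | yes refl = ℤ.+ 1 , χ-right
  ... | no m≢k   | no m≢l   = ℤ.+ 0 , χ-outside m≢k m≢l

  h-col : ∀ m → h k l (col {d} m) ≡ χ m
  h-col m = begin
    h k l (col m)
      ≡⟨ cong (½ *_) (cong₂ _+_ (cong₂ _+_ (cong₂ _+_ (a-col l l m) (a-col l k m)) (a-col k l m)) (a-col k k m)) ⟩
    ½ * (((δ l m + δ k m) + δ l m) + δ k m)
      ≡⟨ solve 2 (λ p q → con ½ :* (((q :+ p) :+ q) :+ p) := p :+ q) refl (δ k m) (δ l m) ⟩
    χ m ∎

  h-row : ∀ m → h k l (row {d} m) ≡ χ m
  h-row m = begin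
    h k l (row m)
      ≡⟨ cong (½ *_) (cong₂ _+_ (cong₂ _+_ (cong₂ _+_ (a-row l l m) (a-row l k m)) (a-row k l m)) (a-row k k m)) ⟩
    ½ * (((δ l m + δ l m) + δ k m) + δ k m)
      ≡⟨ solve 2 (λ p q → con ½ :* (((q :+ q) :+ p) :+ p) := p :+ q) refl (δ k m) (δ l m) ⟩
    χ m ∎

  h-diag : h k l (diag {d}) ≡ 1ℚ
  h-diag = cong (½ *_) (cong₂ _+_ (cong₂ _+_ (cong₂ _+_
    (trans (a-diag l l) (δ-refl l)) (trans (a-diag l k) (δ-≢ (≢-sym k≢l))))
    (trans (a-diag k l) (δ-≢ k≢l)))
    (trans (a-diag k k) (δ-refl k)))

  h-integral : IsIntegral (h k l)
  h-integral c with coordinate {d} c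
  ... | at-col m = map₂ (trans (h-col m)) (χ-integral m)
  ... | at-row m = map₂ (trans (h-row m)) (χ-integral m)
  ... | at-diag  = ℤ.+ 1 , h-diag

  halfBlock : Fin d → Fin d → ℚ
  halfBlock i j = ½ * (χ i * χ j)

  halfBlock-nonNeg : ∀ i j → 0ℚ ℚ.≤ halfBlock i j
  halfBlock-nonNeg i j = ℚP.nonNegative⁻¹ (halfBlock i j) {{ℚP.nonNeg*nonNeg⇒nonNeg ½ (χ i * χ j) {{χᵢχⱼ-nonNeg}}}}
    where
    χᵢχⱼ-nonNeg : NonNegative (χ i * χ j)
    χᵢχⱼ-nonNeg = ℚP.nonNeg*nonNeg⇒nonNeg (χ i) {{χ-nonNeg i}} (χ j) {{χ-nonNeg j}}

  halfBlock-outside-row : ∀ {i} → i ≢ k → i ≢ l → ∀ j → halfBlock i j ≡ 0ℚ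
  halfBlock-outside-row i≢k i≢l j =
    trans (cong (λ t → ½ * (t * χ j)) (χ-outside i≢k i≢l)) (cong (½ *_) (ℚP.*-zeroˡ (χ j)))

  halfBlock-outside-col : ∀ {j} → j ≢ k → j ≢ l → ∀ i → halfBlock i j ≡ 0ℚ
  halfBlock-outside-col j≢k j≢l i =
    trans (cong (λ t → ½ * (χ i * t)) (χ-outside j≢k j≢l)) (cong (½ *_) (ℚP.*-zeroʳ (χ i)))

  comb-halfBlock : ∀ c → comb halfBlock c ≡ h k l c
  comb-halfBlock c with coordinate {d} c
  ... | at-col m = begin
    comb halfBlock (col m)          ≡⟨ comb-col halfBlock m ⟩
    ∑ℚ (λ i → halfBlock i m)        ≡⟨ ∑ℚ-pair k≢l (λ i i≢k i≢l → halfBlock-outside-row i≢k i≢l m) ⟩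
    halfBlock k m + halfBlock l m   ≡⟨ cong₂ (λ s t → ½ * (s * χ m) + ½ * (t * χ m)) χ-left χ-right ⟩
    ½ * (1ℚ * χ m) + ½ * (1ℚ * χ m) ≡⟨ solve 1 (λ t → con ½ :* (con 1ℚ :* t) :+ con ½ :* (con 1ℚ :* t) := t)
                                               refl (χ m) ⟩
    χ m                             ≡⟨ h-col m ⟨
    h k l (col m)                   ∎
  ... | at-row m = begin
    comb halfBlock (row m)          ≡⟨ comb-row halfBlock m ⟩
    ∑ℚ (halfBlock m)                ≡⟨ ∑ℚ-pair k≢l (λ j j≢k j≢l → halfBlock-outside-col j≢k j≢l m) ⟩
    halfBlock m k + halfBlock m l   ≡⟨ cong₂ (λ s t → ½ * (χ m * s) + ½ * (χ m * t)) χ-left χ-right ⟩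
    ½ * (χ m * 1ℚ) + ½ * (χ m * 1ℚ) ≡⟨ solve 1 (λ t → con ½ :* (t :* con 1ℚ) :+ con ½ :* (t :* con 1ℚ) := t)
                                               refl (χ m) ⟩
    χ m                             ≡⟨ h-row m ⟨
    h k l (row m)                   ∎
  ... | at-diag = begin
    comb halfBlock (diag {d})       ≡⟨ comb-diag halfBlock ⟩
    ∑ℚ (λ i → halfBlock i i)        ≡⟨ ∑ℚ-pair k≢l (λ i i≢k i≢l → halfBlock-outside-row i≢k i≢l i) ⟩
    halfBlock k k + halfBlock l l   ≡⟨ cong₂ (λ s t → ½ * (s * s) + ½ * (t * t)) χ-left χ-right ⟩
    ½ * (1ℚ * 1ℚ) + ½ * (1ℚ * 1ℚ)   ≡⟨ h-diag ⟨
    h k l (diag {d})                ∎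

  h∈K : InK d (h k l)
  h∈K = halfBlock , halfBlock-nonNeg , comb-halfBlock

  h∉Q : ¬ InQ d (h k l)
  h∉Q (x , comb≡h) = block-trace≢1 x k≢l
    (λ i i≢k i≢l → ℕtoℚ-injective (trans (rowSum≡χ i) (χ-outside i≢k i≢l)))
    (λ j j≢k j≢l → ℕtoℚ-injective (trans (colSum≡χ j) (χ-outside j≢k j≢l)))
    (ℕtoℚ-injective (trans (rowSum≡χ k) χ-left))
    (ℕtoℚ-injective (trans (colSum≡χ l) χ-right))
    (ℕtoℚ-injective trace≡1)
    where
    x̂ : Fin d → Fin d → ℚ
    x̂ i j = ℕtoℚ (x i j)
    rowSum≡χ : ∀ m → ℕtoℚ (rowSum x m) ≡ χ m
    rowSum≡χ m = trans (ℕtoℚ-∑ (x m)) (trans (sym (comb-row x̂ m)) (trans (comb≡h (row m)) (h-row m)))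
    colSum≡χ : ∀ m → ℕtoℚ (colSum x m) ≡ χ m
    colSum≡χ m = trans (ℕtoℚ-∑ (λ i → x i m)) (trans (sym (comb-col x̂ m)) (trans (comb≡h (col m)) (h-col m)))
    trace≡1 : ℕtoℚ (trace x) ≡ 1ℚ
    trace≡1 = trans (ℕtoℚ-∑ (λ i → x i i)) (trans (sym (comb-diag x̂)) (trans (comb≡h (diag {d})) h-diag))

mainTheorem1 : (d : ℕ) → 1 ≤ d → (k l : Fin d) → k < l →
    (InK d (h k l) × IsIntegral (h k l)) × (InQsat d (h k l) × ¬ InQ d (h k l))
mainTheorem1 d _ k l k<l = (h∈K k≢l , h-integral k≢l) , (h∈K k≢l , h-integral k≢l) , h∉Q k≢l
  where
  k≢l : k ≢ l
  k≢l = FinP.<⇒≢ k<l
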